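{- Let $S=\{n_1,n_2,\ldots,n_s\}$ be a set of integers with $2\le n_s<\cdots<n_2<n_1$, and suppose $n_1-1\in S$ (i.e. $n_2=n_1-1$). Let $X''=X_{n_1,\ldots,n_s}\setminus\{(n_2,1,\ldots,1)\}$ and let $\mathcal G^*_{n_1,\ldots,n_s}$ be the derived sub-hypergraph of $\mathcal H^*_{n_1,\ldots,n_s}=(X_{n_1,\ldots,n_s},\mathcal C_{n_1,\ldots,n_s},\mathcal D^*_{n_1,\ldots,n_s})$ on $X''$. Then $\mathcal G^*_{n_1,\ldots,n_s}$ is a one-realization of $S$.
   Context: A mixed hypergraph is a triple $\mathcal H=(X,\mathcal C,\mathcal D)$ where $X$ is a finite set and $\mathcal C,\mathcal D$ are families of subsets of $X$ ($\mathcal C$-edges and $\mathcal D$-edges). A proper $k$-coloring is a map from $X$ to a set of $k$ colors such that every $\mathcal C$-edge contains two vertices of a common color and every $\mathcal D$-edge contains two vertices of distinct colors; it is strict if all $k$ colors are used. Colorings are identified with partitions of $X$ into color classes. The feasible set is the set of $k$ for which a strict $k$-coloring exists; $r_k$ is the number of partitions arising as strict $k$-colorings. $\mathcal H$ is a one-realization of $S$ if its feasible set is $S$ and $r_k=1$ for all $k\in S$. The derived sub-hypergraph of $(X,\mathcal C,\mathcal D)$ on $X'\subseteq X$ is $(X',\{C\in\mathcal C: C\subseteq X'\},\{D\in\mathcal D: D\subseteq X'\})$. Notation: $[m]=\{1,\ldots,m\}$. Vertices are $s$-tuples of integers. For $t\in\{2,\ldots,s\}$ and an integer $j$, let $u_t(j)=(j,\ldots,j,n_t,n_{t+1},\ldots,n_s)$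 and $v_t(j)=(j,\ldots,j,1,\ldots,1)$, where in both $j$ is repeated $t-1$ times. Define $X_{n_1,\ldots,n_s}=\{(n_1,\ldots,n_s)\}\cup\{(i,\ldots,i): i\in[n_s-1]\}\cup\{u_t(j),v_t(j): 2\le t\le s,\ n_t\le j\le n_{t-1}-1\}$; $\mathcal C_{n_1,\ldots,n_s}$ = all 3-element subsets $\{(x_1,\ldots,x_s),(y_1,\ldots,y_s),(z_1,\ldots,z_s)\}$ of $X_{n_1,\ldots,n_s}$ with $|\{x_j,y_j,z_j\}|=2$ for every $j\in[s]$; $\mathcal D^*_{n_1,\ldots,n_s}$ = the pairs $\{(i,\ldots,i),(j,\ldots,j)\}$ with $i\neq j$, $i,j\in[n_s-1]$; the pairs $\{(i,\ldots,i),(x_1,\ldots,x_{s-1},n_s)\}$ with $i\in[n_s-1]$ and $(x_1,\ldots,x_{s-1},n_s)\in X_{n_1,\ldots,n_s}$; and the pairs $\{(x_1,\ldots,x_{s-1},1),(y_1,\ldots,y_{s-1},n_s)\}$ of elements of $X_{n_1,\ldots,n_s}$ with $x_i<y_i$ for all $i\in[s-1]$. -}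

module Defs where

open import Data.Nat using (ℕ; zero; suc; _∸_; _≤_; _<_; _<ᵇ_)
open import Data.Fin using (Fin; toℕ)
open import Data.Vec using (Vec; tabulate; lookup)
open import Data.List using (List; []; _∷_)
open import Data.List.Membership.Propositional using (_∈_)
open import Data.List.Relation.Unary.All using (All)
open import Data.Product using (Σ; ∃; ∃-syntax; _×_; _,_)
open import Data.Sum using (_⊎_)
open import Data.Bool using (if_then_else_)
open import Relation.Binary.PropositionalEquality using (_≡_; _≢_)
open import Relation.Nullary using (¬_)
open import Function.Bundles using (_⇔_)

-- The vertex set X is a predicate on V; C- and D-edges are subsets of X,
-- represented as lists of vertices (listing the elements of the subset).

record MixedHypergraph (V : Set) : Set₁ where
  field
    Vert  : V → Set
    CEdge : List V → Set
    DEdge : List V → Set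

open MixedHypergraph public

module _ {V : Set} (H : MixedHypergraph V) where

  ProperColoring : (k : ℕ) → (V → Fin k) → Set
  ProperColoring k f =
    (∀ E → CEdge H E → ∃[ x ] ∃[ y ] (x ∈ E × y ∈ E × x ≢ y × f x ≡ f y))
    × (∀ E → DEdge H E → ∃[ x ] ∃[ y ] (x ∈ E × y ∈ E × f x ≢ f y))

  Surjective : (k : ℕ) → (V → Fin k) → Set
  Surjective k f = ∀ (c : Fin k) → ∃[ x ] (Vert H x × f x ≡ c)

  StrictColoring : (k : ℕ) → (V → Fin k) → Set
  StrictColoring k f = ProperColoring k f × Surjective k f

  SamePartition : {k l : ℕ} → (V → Fin k) → (V → Fin l) → Set
  SamePartition f g =
    ∀ x y → Vert H x → Vert H y → (f x ≡ f y ⇔ g x ≡ g y)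

  Feasible : ℕ → Set
  Feasible k = ∃[ f ] StrictColoring k f

  OneRealization : (ℕ → Set) → Set
  OneRealization S =
    (∀ k → (Feasible k ⇔ S k))
    × (∀ k → S k → ∀ (f g : V → Fin k) →
         StrictColoring k f → StrictColoring k g → SamePartition f g)

derived : {V : Set} → MixedHypergraph V → (V → Set) → MixedHypergraph V
derived H X' = record
  { Vert  = λ x → Vert H x × X' x
  ; CEdge = λ E → CEdge H E × All X' E
  ; DEdge = λ E → DEdge H E × All X' E
  }

-- The hypergraph H*_{n_1,...,n_s}.  The sequence is n : ℕ → ℕ, used
-- 1-based (n 1, ..., n s); vertices are s-tuples Vec ℕ s.

module _ (s : ℕ) (n : ℕ → ℕ) where

  tup : (ℕ → ℕ) → Vec ℕ s
  tup f = tabulate (λ i → f (suc (toℕ i)))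

  nvec : Vec ℕ s
  nvec = tup n

  diag : ℕ → Vec ℕ s
  diag i = tup (λ _ → i)

  -- u_t(j) = (j,...,j,n_t,...,n_s), v_t(j) = (j,...,j,1,...,1), j repeated t-1 times
  uvec : ℕ → ℕ → Vec ℕ s
  uvec t j = tup (λ p → if p <ᵇ t then j else n p)

  vvec : ℕ → ℕ → Vec ℕ s
  vvec t j = tup (λ p → if p <ᵇ t then j else 1)

  InX : Vec ℕ s → Set
  InX x =
    x ≡ nvec
    ⊎ (∃[ i ] (1 ≤ i × i < n s × x ≡ diag i))
    ⊎ (∃[ t ] ∃[ j ] (2 ≤ t × t ≤ s × n t ≤ j × j < n (t ∸ 1)
                      × (x ≡ uvec t j ⊎ x ≡ vvec t j)))

  -- |{a,b,c}| = 2
  TwoValues : ℕ → ℕ → ℕ → Set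
  TwoValues a b c = (a ≡ b ⊎ a ≡ c ⊎ b ≡ c) × ¬ (a ≡ b × a ≡ c)

  LastIs : Vec ℕ s → ℕ → Set
  LastIs x a = ∀ (p : Fin s) → suc (toℕ p) ≡ s → lookup x p ≡ a

  CEdge* : List (Vec ℕ s) → Set
  CEdge* E = ∃[ x ] ∃[ y ] ∃[ z ]
    ( E ≡ x ∷ y ∷ z ∷ []
    × InX x × InX y × InX z
    × x ≢ y × x ≢ z × y ≢ z
    × (∀ (p : Fin s) → TwoValues (lookup x p) (lookup y p) (lookup z p)))

  DEdge* : List (Vec ℕ s) → Set
  DEdge* E = ∃[ x ] ∃[ y ]
    ( E ≡ x ∷ y ∷ []
    × ( (∃[ i ] ∃[ j ] (i ≢ j × 1 ≤ i × i < n s × 1 ≤ j × j < n s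
                         × x ≡ diag i × y ≡ diag j))
      ⊎ (∃[ i ] (1 ≤ i × i < n s × x ≡ diag i × InX y × LastIs y (n s)))
      ⊎ (InX x × InX y × LastIs x 1 × LastIs y (n s)
         × (∀ (p : Fin s) → suc (toℕ p) < s → lookup x p < lookup y p))))

  H* : MixedHypergraph (Vec ℕ s)
  H* = record { Vert = InX ; CEdge = CEdge* ; DEdge = DEdge* }

  wvec : Vec ℕ s
  wvec = tup (λ p → if p <ᵇ 2 then n 2 else 1)

  G* : MixedHypergraph (Vec ℕ s)
  G* = derived H* (λ x → x ≢ wvec)

  SetS : ℕ → Set
  SetS k = ∃[ t ] (1 ≤ t × t ≤ s × k ≡ n t)

-- Colouring a vertex by its p-th coordinate is a strict n_p-colouring, so every n_p is feasible.
-- Conversely, let f be a proper colouring. If f separates u_t(j) from v_t(j) for some t ≥ 3, the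
-- C-edges {u_t(j), v_t(j), x} force all u_t'(j'), t' ≤ t, into the colour of (n_1,…,n_s) and all
-- v_t'(j') into that of (1,…,1); above the last such layer r every u_t(j) shares its colour with
-- v_t(j). (Without such layers, r is 1 or 2 according to the colour of u_2(n_2), the only vertex
-- left in layer 2 once (n_2,1,…,1) is removed.) Hence every vertex has the colour and the r-th
-- coordinate of one of (n_1,…,n_s), (i,…,i) or u_t(j) with t > r; the D-edges give these
-- pairwise distinct colours and they have distinct r-th coordinates, so f induces the partition
-- by the r-th coordinate. Counting colours then gives k = n_r, and r is determined by k.

module Submission where

open import Defs
open import Data.Nat using (ℕ; zero; suc; _∸_; _≤_; _<_; _<ᵇ_; z≤n; s≤s; _<?_; _≤?_; _≟_; NonZero; >-nonZero)
open import Data.Nat.Properties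
open import Data.Nat.DivMod using (_mod_; m<n⇒m%n≡m)
open import Data.Fin using (Fin; toℕ; fromℕ<)
open import Data.Fin.Properties
  using (toℕ-fromℕ<; toℕ-injective; toℕ<n; cantor-schröder-bernstein) renaming (_≟_ to _≟ᶠ_)
open import Data.Vec using (Vec; lookup)
open import Data.Vec.Properties using (lookup∘tabulate)
open import Data.List using ([]; _∷_)
open import Data.List.Relation.Unary.Any using (here; there)
open import Data.List.Relation.Unary.All using ([]; _∷_)
open import Data.List.Membership.Propositional using (_∈_)
open import Data.Product using (Σ; ∃-syntax; _×_; _,_; proj₁; proj₂)
open import Data.Sum using (_⊎_; inj₁; inj₂)
open import Data.Bool using (true; false; if_then_else_; T)
open import Data.Unit using (tt)
open import Relation.Binary.PropositionalEquality
open import Relation.Binary.Definitions using (tri<; tri≈; tri>)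
open import Relation.Nullary using (¬_; yes; no; Dec)
open import Relation.Nullary.Decidable using (_×-dec_; ¬?)
open import Relation.Nullary.Negation using (contradiction)
open import Function using (_∘_)
open import Function.Definitions using (Injective)
open import Function.Bundles using (_⇔_; mk⇔; Equivalence)
open import Function.Properties.Equivalence using () renaming (sym to ⇔-sym; trans to ⇔-trans)

module _ {V : Set} (H : MixedHypergraph V) where

  SamePartition-sym : ∀ {k l} {f : V → Fin k} {g : V → Fin l}
    → SamePartition H f g → SamePartition H g f
  SamePartition-sym f~g x y vx vy = ⇔-sym (f~g x y vx vy)

  SamePartition-trans : ∀ {k l m} {f : V → Fin k} {g : V → Fin l} {h : V → Fin m}
    → SamePartition H f g → SamePartition H g h → SamePartition H f h
  SamePartition-trans f~g g~h x y vx vy = ⇔-trans (f~g x y vx vy) (g~h x y vx vy)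

  recolour : ∀ {k m} {f : V → Fin k} → Surjective H k f → (V → Fin m) → Fin k → Fin m
  recolour f-onto g c = g (proj₁ (f-onto c))

  recolour-injective : ∀ {k m} {f : V → Fin k} {g : V → Fin m} (f-onto : Surjective H k f)
    → SamePartition H f g → Injective _≡_ _≡_ (recolour f-onto g)
  recolour-injective f-onto f~g {c} {c′} eq =
    let x , vx , fx≡c = f-onto c ; y , vy , fy≡c′ = f-onto c′
    in trans (sym fx≡c) (trans (Equivalence.from (f~g x y vx vy) eq) fy≡c′)

  surjective-samePartition⇒≡ : ∀ {k m} {f : V → Fin k} {g : V → Fin m}
    → Surjective H k f → Surjective H m g → SamePartition H f g → k ≡ m
  surjective-samePartition⇒≡ f-onto g-onto f~g = cantor-schröder-bernstein
    (recolour-injective f-onto f~g) (recolour-injective g-onto (SamePartition-sym f~g))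

  OneRealization-cong : ∀ {S S′ : ℕ → Set}
    → (∀ k → S k ⇔ S′ k) → OneRealization H S → OneRealization H S′
  OneRealization-cong S⇔S′ (feasible⇔S , unique) =
    (λ k → ⇔-trans (feasible⇔S k) (S⇔S′ k)) ,
    (λ k S′k → unique k (Equivalence.from (S⇔S′ k) S′k))

  module _ {I : Set} (size : I → ℕ) (size-injective : ∀ {i j} → size i ≡ size j → i ≡ j)
           (canonical : (i : I) → V → Fin (size i))
           (canonical-strict : ∀ i → StrictColoring H (size i) (canonical i))
           (classify : ∀ {k} (f : V → Fin k) → ProperColoring H k f
                       → ∃[ i ] SamePartition H f (canonical i))
           where

    strict⇒canonical : ∀ {k} (f : V → Fin k) → StrictColoring H k f
      → ∃[ i ] (k ≡ size i × SamePartition H f (canonical i))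
    strict⇒canonical f (proper , f-onto) =
      let i , f~c = classify f proper
      in i , surjective-samePartition⇒≡ f-onto (proj₂ (canonical-strict i)) f~c , f~c

    oneRealization-of-canonical : OneRealization H (λ k → ∃[ i ] k ≡ size i)
    oneRealization-of-canonical = (λ k → mk⇔ feasible⇒size size⇒feasible) , unique
      where
      feasible⇒size : ∀ {k} → Feasible H k → ∃[ i ] k ≡ size i
      feasible⇒size (f , strict) = let i , k≡i , _ = strict⇒canonical f strict in i , k≡i

      size⇒feasible : ∀ {k} → ∃[ i ] k ≡ size i → Feasible H k
      size⇒feasible (i , refl) = canonical i , canonical-strict i

      unique : ∀ k → ∃[ i ] k ≡ size i → ∀ (f g : V → Fin k)
        → StrictColoring H k f → StrictColoring H k g → SamePartition H f g
      unique k _ f g f-strict g-strict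
        with strict⇒canonical f f-strict | strict⇒canonical g g-strict
      ... | i , k≡i , f~c | j , k≡j , g~c with size-injective (trans (sym k≡i) k≡j)
      ... | refl = SamePartition-trans f~c (SamePartition-sym g~c)

module _ {A B : Set} (f : A → B) where

  pair-separated : ∀ {a b}
    → ∃[ x ] ∃[ y ] (x ∈ a ∷ b ∷ [] × y ∈ a ∷ b ∷ [] × f x ≢ f y) → f a ≢ f b
  pair-separated (_ , _ , here refl , here refl , fx≢fy) = contradiction refl fx≢fy
  pair-separated (_ , _ , here refl , there (here refl) , fx≢fy) = fx≢fy
  pair-separated (_ , _ , there (here refl) , here refl , fx≢fy) = fx≢fy ∘ sym
  pair-separated (_ , _ , there (here refl) , there (here refl) , fx≢fy) = contradiction refl fx≢fy

  triple-monochromatic : ∀ {a b c}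
    → ∃[ x ] ∃[ y ] (x ∈ a ∷ b ∷ c ∷ [] × y ∈ a ∷ b ∷ c ∷ [] × x ≢ y × f x ≡ f y)
    → f a ≡ f b ⊎ f a ≡ f c ⊎ f b ≡ f c
  triple-monochromatic (_ , _ , here refl , here refl , x≢y , _) = contradiction refl x≢y
  triple-monochromatic (_ , _ , here refl , there (here refl) , _ , eq) = inj₁ eq
  triple-monochromatic (_ , _ , here refl , there (there (here refl)) , _ , eq) = inj₂ (inj₁ eq)
  triple-monochromatic (_ , _ , there (here refl) , here refl , _ , eq) = inj₁ (sym eq)
  triple-monochromatic (_ , _ , there (here refl) , there (here refl) , x≢y , _) = contradiction refl x≢y
  triple-monochromatic (_ , _ , there (here refl) , there (there (here refl)) , _ , eq) = inj₂ (inj₂ eq)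
  triple-monochromatic (_ , _ , there (there (here refl)) , here refl , _ , eq) = inj₂ (inj₁ (sym eq))
  triple-monochromatic (_ , _ , there (there (here refl)) , there (here refl) , _ , eq) = inj₂ (inj₂ (sym eq))
  triple-monochromatic (_ , _ , there (there (here refl)) , there (there (here refl)) , x≢y , _) =
    contradiction refl x≢y

if-<ᵇ-then : ∀ {A : Set} {a b} {x y : A} → a < b → (if a <ᵇ b then x else y) ≡ x
if-<ᵇ-then {a = a} {b} a<b with a <ᵇ b | <⇒<ᵇ a<b
... | true | _ = refl

if-<ᵇ-else : ∀ {A : Set} {a b} {x y : A} → b ≤ a → (if a <ᵇ b then x else y) ≡ y
if-<ᵇ-else {a = a} {b} b≤a with a <ᵇ b in eq
... | false = refl
... | true = contradiction (<ᵇ⇒< a b (subst T (sym eq) tt)) (≤⇒≯ b≤a)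

crossing-point : ∀ (n : ℕ → ℕ) {r w} m → r ≤ m → n m ≤ w → w < n r
  → ∃[ t ] (r < t × t ≤ m × n t ≤ w × w < n (t ∸ 1))
crossing-point n {r} {w} m r≤m nm≤w w<nr with m≤n⇒m<n∨m≡n r≤m
... | inj₂ refl = contradiction w<nr (≤⇒≯ nm≤w)
crossing-point n {r} {w} (suc m) _ n[1+m]≤w w<nr | inj₁ (s≤s r≤m) with w <? n m
... | yes w<nm = suc m , s≤s r≤m , ≤-refl , n[1+m]≤w , w<nm
... | no w≮nm =
  let t , r<t , t≤m , nt≤w , w<n[t-1] = crossing-point n m r≤m (≮⇒≥ w≮nm) w<nr
  in t , r<t , m≤n⇒m≤1+n t≤m , nt≤w , w<n[t-1]

largest-below : ∀ {P : ℕ → Set} → (∀ t → Dec (P t)) → ∀ m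
  → (∃[ r ] (r ≤ m × P r × ∀ t → r < t → t ≤ m → ¬ P t)) ⊎ (∀ t → t ≤ m → ¬ P t)
largest-below P? zero with P? zero
... | yes P0 = inj₁ (zero , z≤n , P0 , λ t 0<t t≤0 → contradiction t≤0 (<⇒≱ 0<t))
... | no ¬P0 = inj₂ λ { zero z≤n → ¬P0 }
largest-below {P} P? (suc m) with P? (suc m)
... | yes P[1+m] = inj₁ (suc m , ≤-refl , P[1+m] , λ t m<t t≤m → contradiction t≤m (<⇒≱ m<t))
... | no ¬P[1+m] with largest-below P? m
... | inj₁ (r , r≤m , Pr , none-above) = inj₁ (r , m≤n⇒m≤1+n r≤m , Pr , none-above′)
  where
  none-above′ : ∀ t → r < t → t ≤ suc m → ¬ P t
  none-above′ t r<t t≤1+m with m≤n⇒m<n∨m≡n t≤1+m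
  ... | inj₁ (s≤s t≤m) = none-above t r<t t≤m
  ... | inj₂ refl = ¬P[1+m]
... | inj₂ none = inj₂ none′
  where
  none′ : ∀ t → t ≤ suc m → ¬ P t
  none′ t t≤1+m with m≤n⇒m<n∨m≡n t≤1+m
  ... | inj₁ (s≤s t≤m) = none t t≤m
  ... | inj₂ refl = ¬P[1+m]

module StrictlyDecreasing {s : ℕ} {n : ℕ → ℕ} (step : ∀ t → 1 ≤ t → t < s → n (suc t) < n t) where

  antitone : ∀ {a b} → 1 ≤ a → a ≤ b → b ≤ s → n b ≤ n a
  antitone {a} {b} 1≤a a≤b b≤s with m≤n⇒m<n∨m≡n a≤b
  ... | inj₂ refl = ≤-refl
  antitone {a} {suc b} 1≤a _ b<s | inj₁ (s≤s a≤b) =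
    ≤-trans (<⇒≤ (step b (≤-trans 1≤a a≤b) b<s)) (antitone 1≤a a≤b (<⇒≤ b<s))

  strictly-antitone : ∀ {a b} → 1 ≤ a → a < b → b ≤ s → n b < n a
  strictly-antitone {a} {suc b} 1≤a (s≤s a≤b) b<s =
    <-≤-trans (step b (≤-trans 1≤a a≤b) b<s) (antitone 1≤a a≤b (<⇒≤ b<s))

  injective : ∀ {a b} → 1 ≤ a → a ≤ s → 1 ≤ b → b ≤ s → n a ≡ n b → a ≡ b
  injective {a} {b} 1≤a a≤s 1≤b b≤s na≡nb with <-cmp a b
  ... | tri< a<b _ _ = contradiction (sym na≡nb) (<⇒≢ (strictly-antitone 1≤a a<b b≤s))
  ... | tri≈ _ a≡b _ = a≡b
  ... | tri> _ _ b<a = contradiction na≡nb (<⇒≢ (strictly-antitone 1≤b b<a a≤s))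

module Construction (s : ℕ) (n : ℕ → ℕ) (2≤s : 2 ≤ s) (2≤nₛ : 2 ≤ n s)
  (step : ∀ t → 1 ≤ t → t < s → n (suc t) < n t) (n₂≡n₁∸1 : n 2 ≡ n 1 ∸ 1) where

  open StrictlyDecreasing step

  Tuple : Set
  Tuple = Vec ℕ s

  N : Tuple
  N = nvec s n

  D : ℕ → Tuple
  D = diag s n

  U V : ℕ → ℕ → Tuple
  U = uvec s n
  V = vvec s n

  Vertex : Tuple → Set
  Vertex = Vert (G* s n)

  private variable
    i j j′ q t t′ : ℕ
    x y z : Tuple

  1≤s : 1 ≤ s
  1≤s = ≤-trans (s≤s z≤n) 2≤s

  nₛ≤n : 1 ≤ q → q ≤ s → n s ≤ n q
  nₛ≤n 1≤q q≤s = antitone 1≤q q≤s ≤-refl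

  2≤n : 1 ≤ q → q ≤ s → 2 ≤ n q
  2≤n 1≤q q≤s = ≤-trans 2≤nₛ (nₛ≤n 1≤q q≤s)

  pos : Fin s → ℕ
  pos p = suc (toℕ p)

  pos≤s : ∀ p → pos p ≤ s
  pos≤s = toℕ<n

  position : 1 ≤ q → q ≤ s → ∃[ p ] pos p ≡ q
  position {suc q} _ q<s = fromℕ< q<s , cong suc (toℕ-fromℕ< q<s)

  differ-at : 1 ≤ q → q ≤ s → (∀ p → pos p ≡ q → lookup x p ≢ lookup y p) → x ≢ y
  differ-at 1≤q q≤s differ refl = let p , p≡q = position 1≤q q≤s in differ p p≡q refl

  lookup-tup : ∀ g p → lookup (tup s n g) p ≡ g (pos p)
  lookup-tup g p = lookup∘tabulate (λ i → g (pos i)) p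

  N-at : ∀ p → lookup N p ≡ n (pos p)
  N-at = lookup-tup n

  D-at : ∀ i p → lookup (D i) p ≡ i
  D-at i = lookup-tup (λ _ → i)

  U-at-< : ∀ j p → pos p < t → lookup (U t j) p ≡ j
  U-at-< {t} j p p<t = trans (lookup-tup (λ q → if q <ᵇ t then j else n q) p) (if-<ᵇ-then p<t)

  U-at-≥ : ∀ j p → t ≤ pos p → lookup (U t j) p ≡ n (pos p)
  U-at-≥ {t} j p t≤p = trans (lookup-tup (λ q → if q <ᵇ t then j else n q) p) (if-<ᵇ-else t≤p)

  V-at-< : ∀ j p → pos p < t → lookup (V t j) p ≡ j
  V-at-< {t} j p p<t = trans (lookup-tup (λ q → if q <ᵇ t then j else 1) p) (if-<ᵇ-then p<t)

  V-at-≥ : ∀ j p → t ≤ pos p → lookup (V t j) p ≡ 1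
  V-at-≥ {t} j p t≤p = trans (lookup-tup (λ q → if q <ᵇ t then j else 1) p) (if-<ᵇ-else t≤p)

  N-last : LastIs s n N (n s)
  N-last p p≡s = trans (N-at p) (cong n p≡s)

  U-last : t ≤ s → LastIs s n (U t j) (n s)
  U-last {t} {j} t≤s p p≡s = trans (U-at-≥ j p (subst (t ≤_) (sym p≡s) t≤s)) (cong n p≡s)

  V-last : t ≤ s → LastIs s n (V t j) 1
  V-last {t} {j} t≤s p p≡s = V-at-≥ j p (subst (t ≤_) (sym p≡s) t≤s)

  record Layer (t j : ℕ) : Set where
    constructor layer
    field
      2≤t : 2 ≤ t
      t≤s : t ≤ s
      n≤j : n t ≤ j
      j<n : j < n (t ∸ 1)

  open Layer

  layer-below : Layer t j → 1 ≤ q → q < t → j < n q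
  layer-below {suc t} L 1≤q (s≤s q≤t) =
    <-≤-trans (j<n L) (antitone 1≤q q≤t (≤-trans (n≤1+n t) (t≤s L)))

  nₛ≤j : Layer t j → n s ≤ j
  nₛ≤j L = ≤-trans (nₛ≤n (≤-trans (s≤s z≤n) (2≤t L)) (t≤s L)) (n≤j L)

  2≤j : Layer t j → 2 ≤ j
  2≤j L = ≤-trans 2≤nₛ (nₛ≤j L)

  layer-antitone : Layer t j → Layer t′ j′ → j ≤ j′ → t′ ≤ t
  layer-antitone L L′ j≤j′ = ≮⇒≥ λ t<t′ →
    contradiction (≤-trans (n≤j L) j≤j′) (<⇒≱ (layer-below L′ (≤-trans (s≤s z≤n) (2≤t L)) t<t′))

  layer-unique : Layer t j → Layer t′ j → t ≡ t′
  layer-unique L L′ = ≤-antisym (layer-antitone L′ L ≤-refl) (layer-antitone L L′ ≤-refl)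

  top-layer : 2 ≤ t → t ≤ s → Layer t (n t)
  top-layer {suc t} 2≤t t<s = layer 2≤t t<s ≤-refl (step t (≤-pred 2≤t) t<s)

  -- Because n₂ = n₁ - 1, layer 2 consists of n₂ alone.
  second-layer : Layer t j → t ≤ 2 → t ≡ 2 × j ≡ n 2
  second-layer L t≤2 with ≤-antisym t≤2 (2≤t L)
  ... | refl = refl , ≤-antisym (subst (_ ≤_) (sym n₂≡n₁∸1) (<⇒≤pred (j<n L))) (n≤j L)

  layer-cases : Layer t j → t ≡ 2 ⊎ 3 ≤ t
  layer-cases L with m≤n⇒m<n∨m≡n (2≤t L)
  ... | inj₁ 2<t = inj₂ 2<t
  ... | inj₂ 2≡t = inj₁ (sym 2≡t)

  N∈X : InX s n N
  N∈X = inj₁ refl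

  D∈X : 1 ≤ i → i < n s → InX s n (D i)
  D∈X 1≤i i<nₛ = inj₂ (inj₁ (_ , 1≤i , i<nₛ , refl))

  U∈X : Layer t j → InX s n (U t j)
  U∈X (layer 2≤t t≤s n≤j j<n) = inj₂ (inj₂ (_ , _ , 2≤t , t≤s , n≤j , j<n , inj₁ refl))

  V∈X : Layer t j → InX s n (V t j)
  V∈X (layer 2≤t t≤s n≤j j<n) = inj₂ (inj₂ (_ , _ , 2≤t , t≤s , n≤j , j<n , inj₂ refl))

  -- The removed vertex wvec s n is definitionally V 2 (n 2), so V-at-< and V-at-≥ compute it.
  N-vertex : Vertex N
  N-vertex = N∈X , differ-at ≤-refl 1≤s λ p p≡1 →
    subst₂ _≢_ (sym (trans (N-at p) (cong n p≡1))) (sym (V-at-< (n 2) p (subst (_< 2) (sym p≡1) ≤-refl)))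
           (≢-sym (<⇒≢ (step 1 ≤-refl 2≤s)))

  D-vertex : 1 ≤ i → i < n s → Vertex (D i)
  D-vertex {i} 1≤i i<nₛ = D∈X 1≤i i<nₛ , differ-at ≤-refl 1≤s λ p p≡1 →
    subst₂ _≢_ (sym (D-at i p)) (sym (V-at-< (n 2) p (subst (_< 2) (sym p≡1) ≤-refl)))
           (<⇒≢ (<-≤-trans i<nₛ (nₛ≤n (s≤s z≤n) 2≤s)))

  U-vertex : Layer t j → Vertex (U t j)
  U-vertex {t} {j} L = U∈X L , differ-at 1≤s ≤-refl λ p p≡s →
    subst₂ _≢_ (sym (U-last (t≤s L) p p≡s)) (sym (V-last 2≤s p p≡s)) (≢-sym (<⇒≢ 2≤nₛ))

  V-vertex : Layer t j → 3 ≤ t → Vertex (V t j)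
  V-vertex {t} {j} L 3≤t = V∈X L , differ-at (s≤s z≤n) 2≤s λ p p≡2 →
    subst₂ _≢_ (sym (V-at-< j p (subst (_< t) (sym p≡2) 3≤t))) (sym (V-at-≥ (n 2) p (≤-reflexive (sym p≡2))))
           (≢-sym (<⇒≢ (2≤j L)))

  data View : Tuple → Set where
    N-view : View N
    D-view : 1 ≤ i → i < n s → View (D i)
    U-view : Layer t j → View (U t j)
    V-view : Layer t j → 3 ≤ t → View (V t j)

  view : Vertex x → View x
  view (inj₁ refl , _) = N-view
  view (inj₂ (inj₁ (_ , 1≤i , i<nₛ , refl)) , _) = D-view 1≤i i<nₛ
  view (inj₂ (inj₂ (_ , _ , 2≤t , t≤s , n≤j , j<n , inj₁ refl)) , _) = U-view (layer 2≤t t≤s n≤j j<n)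
  view (inj₂ (inj₂ (_ , _ , 2≤t , t≤s , n≤j , j<n , inj₂ refl)) , x≢W)
    with L ← layer 2≤t t≤s n≤j j<n | layer-cases L
  ... | inj₁ refl = contradiction (cong (V 2) (proj₂ (second-layer L ≤-refl))) x≢W
  ... | inj₂ 3≤t = V-view L 3≤t

  InRange : Fin s → ℕ → Set
  InRange p c = 1 ≤ c × c ≤ n (pos p)

  n-in-range : ∀ p → InRange p (n (pos p))
  n-in-range p = ≤-trans (s≤s z≤n) (2≤n (s≤s z≤n) (pos≤s p)) , ≤-refl

  1-in-range : ∀ p → InRange p 1
  1-in-range p = ≤-refl , proj₁ (n-in-range p)

  layer-in-range : ∀ p → Layer t j → pos p < t → InRange p j
  layer-in-range p L p<t = ≤-trans (s≤s z≤n) (2≤j L) , <⇒≤ (layer-below L (s≤s z≤n) p<t)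

  coordinate-in-range : InX s n x → ∀ p → InRange p (lookup x p)
  coordinate-in-range (inj₁ refl) p = subst (InRange p) (sym (N-at p)) (n-in-range p)
  coordinate-in-range (inj₂ (inj₁ (i , 1≤i , i<nₛ , refl))) p =
    subst (InRange p) (sym (D-at i p)) (1≤i , <⇒≤ (<-≤-trans i<nₛ (nₛ≤n (s≤s z≤n) (pos≤s p))))
  coordinate-in-range (inj₂ (inj₂ (t , j , 2≤t , t≤s , n≤j , j<n , U-or-V))) p
    with L ← layer 2≤t t≤s n≤j j<n | pos p <? t | U-or-V
  ... | yes p<t | inj₁ refl = subst (InRange p) (sym (U-at-< j p p<t)) (layer-in-range p L p<t)
  ... | yes p<t | inj₂ refl = subst (InRange p) (sym (V-at-< j p p<t)) (layer-in-range p L p<t)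
  ... | no p≮t | inj₁ refl = subst (InRange p) (sym (U-at-≥ j p (≮⇒≥ p≮t))) (n-in-range p)
  ... | no p≮t | inj₂ refl = subst (InRange p) (sym (V-at-≥ j p (≮⇒≥ p≮t))) (1-in-range p)

  n-nonZero : ∀ p → NonZero (n (pos p))
  n-nonZero p = >-nonZero (≤-trans (s≤s z≤n) (2≤n (s≤s z≤n) (pos≤s p)))

  -- The reduction mod nₚ only makes the map total: on X every coordinate lies in [1, nₚ].
  colour : ∀ p → ℕ → Fin (n (pos p))
  colour p c = _mod_ (c ∸ 1) (n (pos p)) ⦃ n-nonZero p ⦄

  canonical : ∀ p → Tuple → Fin (n (pos p))
  canonical p x = colour p (lookup x p)

  toℕ-colour : ∀ p {c} → InRange p c → toℕ (colour p c) ≡ c ∸ 1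
  toℕ-colour p {suc c} (_ , c<n) = trans (toℕ-fromℕ< _) (m<n⇒m%n≡m ⦃ n-nonZero p ⦄ c<n)

  canonical-≡⇔ : InX s n x → InX s n y → ∀ p → canonical p x ≡ canonical p y ⇔ lookup x p ≡ lookup y p
  canonical-≡⇔ x∈X y∈X p = mk⇔
    (λ e → ∸-cancelʳ-≡ (proj₁ xₚ-range) (proj₁ yₚ-range)
             (trans (sym (toℕ-colour p xₚ-range)) (trans (cong toℕ e) (toℕ-colour p yₚ-range))))
    (cong (colour p))
    where
    xₚ-range = coordinate-in-range x∈X p
    yₚ-range = coordinate-in-range y∈X p

  last-nₛ⇒≥nₛ : InX s n y → LastIs s n y (n s) → ∀ p → n s ≤ lookup y p
  last-nₛ⇒≥nₛ (inj₁ refl) _ p = subst (n s ≤_) (sym (N-at p)) (nₛ≤n (s≤s z≤n) (pos≤s p))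
  last-nₛ⇒≥nₛ (inj₂ (inj₁ (i , _ , i<nₛ , refl))) y-last _ =
    let p , p≡s = position 1≤s ≤-refl
    in contradiction (trans (sym (D-at i p)) (y-last p p≡s)) (<⇒≢ i<nₛ)
  last-nₛ⇒≥nₛ (inj₂ (inj₂ (t , j , 2≤t , t≤s , n≤j , j<n , inj₁ refl))) _ p with pos p <? t
  ... | yes p<t = subst (n s ≤_) (sym (U-at-< j p p<t)) (nₛ≤j (layer 2≤t t≤s n≤j j<n))
  ... | no p≮t = subst (n s ≤_) (sym (U-at-≥ j p (≮⇒≥ p≮t))) (nₛ≤n (s≤s z≤n) (pos≤s p))
  last-nₛ⇒≥nₛ (inj₂ (inj₂ (t , j , _ , t≤s , _ , _ , inj₂ refl))) y-last _ =
    let p , p≡s = position 1≤s ≤-refl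
    in contradiction (trans (sym (V-last t≤s p p≡s)) (y-last p p≡s)) (<⇒≢ 2≤nₛ)

  D-edge-coordinates : ∀ p {E} → DEdge* s n E
    → ∃[ x ] ∃[ y ] (E ≡ x ∷ y ∷ [] × InX s n x × InX s n y × lookup x p ≢ lookup y p)
  D-edge-coordinates p (x , y , E≡xy , inj₁ (i , i′ , i≢i′ , 1≤i , i<nₛ , 1≤i′ , i′<nₛ , refl , refl)) =
    x , y , E≡xy , D∈X 1≤i i<nₛ , D∈X 1≤i′ i′<nₛ , subst₂ _≢_ (sym (D-at i p)) (sym (D-at i′ p)) i≢i′
  D-edge-coordinates p (x , y , E≡xy , inj₂ (inj₁ (i , 1≤i , i<nₛ , refl , y∈X , y-last))) =
    x , y , E≡xy , D∈X 1≤i i<nₛ , y∈X ,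
    subst (_≢ lookup y p) (sym (D-at i p)) (<⇒≢ (<-≤-trans i<nₛ (last-nₛ⇒≥nₛ y∈X y-last p)))
  D-edge-coordinates p (x , y , E≡xy , inj₂ (inj₂ (x∈X , y∈X , x-last , y-last , below)))
    with pos p <? s
  ... | yes p<s = x , y , E≡xy , x∈X , y∈X , <⇒≢ (below p p<s)
  ... | no p≮s = x , y , E≡xy , x∈X , y∈X ,
    subst₂ _≢_ (sym (x-last p p≡s)) (sym (y-last p p≡s)) (<⇒≢ 2≤nₛ)
    where
    p≡s = ≤-antisym (pos≤s p) (≮⇒≥ p≮s)

  canonical-proper : ∀ p → ProperColoring (G* s n) (n (pos p)) (canonical p)
  canonical-proper p = C-edges , D-edges
    where
    C-edges : ∀ E → CEdge (G* s n) E
      → ∃[ x ] ∃[ y ] (x ∈ E × y ∈ E × x ≢ y × canonical p x ≡ canonical p y)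
    C-edges _ ((x , y , z , refl , _ , _ , _ , x≢y , x≢z , y≢z , two-values) , _)
      with proj₁ (two-values p)
    ... | inj₁ xₚ≡yₚ = x , y , here refl , there (here refl) , x≢y , cong (colour p) xₚ≡yₚ
    ... | inj₂ (inj₁ xₚ≡zₚ) = x , z , here refl , there (there (here refl)) , x≢z , cong (colour p) xₚ≡zₚ
    ... | inj₂ (inj₂ yₚ≡zₚ) = y , z , there (here refl) , there (there (here refl)) , y≢z , cong (colour p) yₚ≡zₚ

    D-edges : ∀ E → DEdge (G* s n) E → ∃[ x ] ∃[ y ] (x ∈ E × y ∈ E × canonical p x ≢ canonical p y)
    D-edges _ (edge , _) with D-edge-coordinates p edge
    ... | x , y , refl , x∈X , y∈X , xₚ≢yₚ =
      x , y , here refl , there (here refl) , xₚ≢yₚ ∘ Equivalence.to (canonical-≡⇔ x∈X y∈X p)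

  coordinate-witness : ∀ p {w} → InRange p w → ∃[ x ] (Vertex x × lookup x p ≡ w)
  coordinate-witness p {w} (1≤w , w≤n) with w <? n s
  ... | yes w<nₛ = D w , D-vertex 1≤w w<nₛ , D-at w p
  ... | no w≮nₛ with w ≟ n (pos p)
  ...   | yes refl = N , N-vertex , N-at p
  ...   | no w≢n with crossing-point n s (pos≤s p) (≮⇒≥ w≮nₛ) (≤∧≢⇒< w≤n w≢n)
  ...     | t , p<t , t≤s , n≤w , w<n =
    U t w , U-vertex (layer (≤-trans (s≤s (s≤s z≤n)) p<t) t≤s n≤w w<n) , U-at-< w p p<t

  canonical-surjective : ∀ p → Surjective (G* s n) (n (pos p)) (canonical p)
  canonical-surjective p c with coordinate-witness p (s≤s z≤n , toℕ<n c)
  ... | x , x∈G , xₚ≡1+c = x , x∈G , toℕ-injective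
    (trans (toℕ-colour p (coordinate-in-range (proj₁ x∈G) p)) (cong (_∸ 1) xₚ≡1+c))

  canonical-strict : ∀ p → StrictColoring (G* s n) (n (pos p)) (canonical p)
  canonical-strict p = canonical-proper p , canonical-surjective p

  Completes : ℕ → ℕ → Tuple → Set
  Completes t j x =
    ∀ p → (pos p < t → lookup x p ≢ j) × (t ≤ pos p → lookup x p ≡ n (pos p) ⊎ lookup x p ≡ 1)

  two-values-≡ : ∀ {a b c} → a ≡ b → c ≢ a → TwoValues s n a b c
  two-values-≡ a≡b c≢a = inj₁ a≡b , λ (_ , a≡c) → c≢a (sym a≡c)

  two-values-≢ : ∀ {a b c} → a ≢ b → c ≡ a ⊎ c ≡ b → TwoValues s n a b c
  two-values-≢ a≢b (inj₁ c≡a) = inj₂ (inj₁ (sym c≡a)) , a≢b ∘ proj₁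
  two-values-≢ a≢b (inj₂ c≡b) = inj₂ (inj₂ (sym c≡b)) , a≢b ∘ proj₁

  UV-edge : Layer t j → InX s n x → Completes t j x → CEdge* s n (U t j ∷ V t j ∷ x ∷ [])
  UV-edge {t} {j} {x} L x∈X completes =
    U t j , V t j , x , refl , U∈X L , V∈X L , x∈X ,
    differ-at 1≤s ≤-refl (λ p p≡s →
      subst₂ _≢_ (sym (U-last (t≤s L) p p≡s)) (sym (V-last (t≤s L) p p≡s)) (≢-sym (<⇒≢ 2≤nₛ))) ,
    differ-at ≤-refl 1≤s (λ p p≡1 → subst (_≢ lookup x p) (sym (U-at-< j p (first<t p p≡1))) (x≢j p p≡1)) ,
    differ-at ≤-refl 1≤s (λ p p≡1 → subst (_≢ lookup x p) (sym (V-at-< j p (first<t p p≡1))) (x≢j p p≡1)) ,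
    two-values
    where
    first<t : ∀ p → pos p ≡ 1 → pos p < t
    first<t p p≡1 = subst (_< t) (sym p≡1) (2≤t L)

    x≢j : ∀ p → pos p ≡ 1 → j ≢ lookup x p
    x≢j p p≡1 = ≢-sym (proj₁ (completes p) (first<t p p≡1))

    two-values : ∀ p → TwoValues s n (lookup (U t j) p) (lookup (V t j) p) (lookup x p)
    two-values p with pos p <? t
    ... | yes p<t = subst₂ (λ a b → TwoValues s n a b (lookup x p)) (sym (U-at-< j p p<t)) (sym (V-at-< j p p<t))
                      (two-values-≡ refl (proj₁ (completes p) p<t))
    ... | no p≮t = subst₂ (λ a b → TwoValues s n a b (lookup x p))
                     (sym (U-at-≥ j p (≮⇒≥ p≮t))) (sym (V-at-≥ j p (≮⇒≥ p≮t)))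
                     (two-values-≢ (≢-sym (<⇒≢ (2≤n (s≤s z≤n) (pos≤s p)))) (proj₂ (completes p) (≮⇒≥ p≮t)))

  N-completes : Layer t j → Completes t j N
  N-completes {t} {j} L p =
    (λ p<t → subst (_≢ j) (sym (N-at p)) (≢-sym (<⇒≢ (layer-below L (s≤s z≤n) p<t)))) ,
    (λ _ → inj₁ (N-at p))

  D₁-completes : Layer t j → Completes t j (D 1)
  D₁-completes {t} {j} L p = (λ _ → subst (_≢ j) (sym (D-at 1 p)) (<⇒≢ (2≤j L))) , (λ _ → inj₂ (D-at 1 p))

  U-completes : Layer t j → t′ ≤ t → j′ ≢ j → Completes t j (U t′ j′)
  U-completes {t} {j} {t′} {j′} L t′≤t j′≢j p with pos p <? t′
  ... | yes p<t′ = (λ _ → subst (_≢ j) (sym (U-at-< j′ p p<t′)) j′≢j) ,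
                   (λ t≤p → contradiction (≤-trans t′≤t t≤p) (<⇒≱ p<t′))
  ... | no p≮t′ = (λ p<t → subst (_≢ j) (sym Uₚ≡n) (≢-sym (<⇒≢ (layer-below L (s≤s z≤n) p<t)))) ,
                  (λ _ → inj₁ Uₚ≡n)
    where
    Uₚ≡n = U-at-≥ j′ p (≮⇒≥ p≮t′)

  V-completes : Layer t j → t′ ≤ t → j′ ≢ j → Completes t j (V t′ j′)
  V-completes {t} {j} {t′} {j′} L t′≤t j′≢j p with pos p <? t′
  ... | yes p<t′ = (λ _ → subst (_≢ j) (sym (V-at-< j′ p p<t′)) j′≢j) ,
                   (λ t≤p → contradiction (≤-trans t′≤t t≤p) (<⇒≱ p<t′))
  ... | no p≮t′ = (λ _ → subst (_≢ j) (sym Vₚ≡1) (<⇒≢ (2≤j L))) , (λ _ → inj₂ Vₚ≡1)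
    where
    Vₚ≡1 = V-at-≥ j′ p (≮⇒≥ p≮t′)

  module Classification {k} (f : Tuple → Fin k) (proper : ProperColoring (G* s n) k f) where

    separated : DEdge* s n (x ∷ y ∷ []) → Vertex x → Vertex y → f x ≢ f y
    separated edge (_ , x≢W) (_ , y≢W) = pair-separated f (proj₂ proper _ (edge , x≢W ∷ y≢W ∷ []))

    C-edge-monochromatic : CEdge* s n (x ∷ y ∷ z ∷ []) → Vertex x → Vertex y → Vertex z
      → f x ≡ f y ⊎ f x ≡ f z ⊎ f y ≡ f z
    C-edge-monochromatic edge (_ , x≢W) (_ , y≢W) (_ , z≢W) =
      triple-monochromatic f (proj₁ proper _ (edge , x≢W ∷ y≢W ∷ z≢W ∷ []))

    D≢D : i ≢ j → 1 ≤ i → i < n s → 1 ≤ j → j < n s → f (D i) ≢ f (D j)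
    D≢D i≢j 1≤i i<nₛ 1≤j j<nₛ =
      separated (_ , _ , refl , inj₁ (_ , _ , i≢j , 1≤i , i<nₛ , 1≤j , j<nₛ , refl , refl))
                (D-vertex 1≤i i<nₛ) (D-vertex 1≤j j<nₛ)

    D≢last-nₛ : 1 ≤ i → i < n s → Vertex y → LastIs s n y (n s) → f (D i) ≢ f y
    D≢last-nₛ 1≤i i<nₛ y∈G y-last =
      separated (_ , _ , refl , inj₂ (inj₁ (_ , 1≤i , i<nₛ , refl , proj₁ y∈G , y-last))) (D-vertex 1≤i i<nₛ) y∈G

    D≢N : 1 ≤ i → i < n s → f (D i) ≢ f N
    D≢N 1≤i i<nₛ = D≢last-nₛ 1≤i i<nₛ N-vertex N-last

    D≢U : 1 ≤ i → i < n s → Layer t j → f (D i) ≢ f (U t j)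
    D≢U 1≤i i<nₛ L = D≢last-nₛ 1≤i i<nₛ (U-vertex L) (U-last (t≤s L))

    N≢D₁ : f N ≢ f (D 1)
    N≢D₁ = ≢-sym (D≢N ≤-refl 2≤nₛ)

    V≢last-nₛ : Layer t j → 3 ≤ t → Vertex y → LastIs s n y (n s)
      → (∀ p → pos p < s → lookup (V t j) p < lookup y p) → f (V t j) ≢ f y
    V≢last-nₛ L 3≤t y∈G y-last below =
      separated (_ , _ , refl , inj₂ (inj₂ (V∈X L , proj₁ y∈G , V-last (t≤s L) , y-last , below)))
                (V-vertex L 3≤t) y∈G

    V≢N : Layer t j → 3 ≤ t → f (V t j) ≢ f N
    V≢N {t} {j} L 3≤t = V≢last-nₛ L 3≤t N-vertex N-last below
      where
      below : ∀ p → pos p < s → lookup (V t j) p < lookup N p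
      below p _ with pos p <? t
      ... | yes p<t = subst₂ _<_ (sym (V-at-< j p p<t)) (sym (N-at p)) (layer-below L (s≤s z≤n) p<t)
      ... | no p≮t = subst₂ _<_ (sym (V-at-≥ j p (≮⇒≥ p≮t))) (sym (N-at p)) (2≤n (s≤s z≤n) (pos≤s p))

    V≢U : Layer t j → 3 ≤ t → Layer t′ j′ → t′ ≤ t → j < j′ → f (V t j) ≢ f (U t′ j′)
    V≢U {t} {j} {t′} {j′} L 3≤t L′ t′≤t j<j′ = V≢last-nₛ L 3≤t (U-vertex L′) (U-last (t≤s L′)) below
      where
      below : ∀ p → pos p < s → lookup (V t j) p < lookup (U t′ j′) p
      below p _ with pos p <? t′ | pos p <? t
      ... | yes p<t′ | _ = subst₂ _<_ (sym (V-at-< j p (<-≤-trans p<t′ t′≤t))) (sym (U-at-< j′ p p<t′)) j<j′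
      ... | no p≮t′ | yes p<t = subst₂ _<_ (sym (V-at-< j p p<t)) (sym (U-at-≥ j′ p (≮⇒≥ p≮t′)))
                                  (layer-below L (s≤s z≤n) p<t)
      ... | no p≮t′ | no p≮t = subst₂ _<_ (sym (V-at-≥ j p (≮⇒≥ p≮t))) (sym (U-at-≥ j′ p (≮⇒≥ p≮t′)))
                                 (2≤n (s≤s z≤n) (pos≤s p))

    Split : ℕ → ℕ → Set
    Split t j = f (U t j) ≢ f (V t j)

    completer-colour : Layer t j → 3 ≤ t → Split t j → Vertex x → Completes t j x
      → f x ≡ f (U t j) ⊎ f x ≡ f (V t j)
    completer-colour L 3≤t split x∈G completes
      with C-edge-monochromatic (UV-edge L (proj₁ x∈G) completes) (U-vertex L) (V-vertex L 3≤t) x∈G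
    ... | inj₁ U≡V = contradiction U≡V split
    ... | inj₂ (inj₁ U≡x) = inj₁ (sym U≡x)
    ... | inj₂ (inj₂ V≡x) = inj₂ (sym V≡x)

    split⇒U≡N : Layer t j → 3 ≤ t → Split t j → f (U t j) ≡ f N
    split⇒U≡N L 3≤t split with completer-colour L 3≤t split N-vertex (N-completes L)
    ... | inj₁ N≡U = sym N≡U
    ... | inj₂ N≡V = contradiction (sym N≡V) (V≢N L 3≤t)

    split⇒V≡D₁ : Layer t j → 3 ≤ t → Split t j → f (V t j) ≡ f (D 1)
    split⇒V≡D₁ L 3≤t split with completer-colour L 3≤t split (D-vertex ≤-refl 2≤nₛ) (D₁-completes L)
    ... | inj₁ D₁≡U = contradiction D₁≡U (D≢U ≤-refl 2≤nₛ L)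
    ... | inj₂ D₁≡V = sym D₁≡V

    split⇒lower-U≡N : Layer t j → 3 ≤ t → Split t j → Layer t′ j′ → t′ ≤ t → f (U t′ j′) ≡ f N
    split⇒lower-U≡N {j = j} {j′ = j′} L 3≤t split L′ t′≤t with j′ ≟ j
    ... | yes refl with refl ← layer-unique L′ L = split⇒U≡N L 3≤t split
    ... | no j′≢j with completer-colour L 3≤t split (U-vertex L′) (U-completes L t′≤t j′≢j)
    ...   | inj₁ U′≡U = trans U′≡U (split⇒U≡N L 3≤t split)
    ...   | inj₂ U′≡V = contradiction (sym (trans U′≡V (split⇒V≡D₁ L 3≤t split))) (D≢U ≤-refl 2≤nₛ L′)

    split⇒lower-V≡D₁ : Layer t j → 3 ≤ t → Split t j → Layer t′ j′ → 3 ≤ t′ → t′ ≤ t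
      → f (V t′ j′) ≡ f (D 1)
    split⇒lower-V≡D₁ {j = j} {j′ = j′} L 3≤t split L′ 3≤t′ t′≤t with j′ ≟ j
    ... | yes refl with refl ← layer-unique L′ L = split⇒V≡D₁ L 3≤t split
    ... | no j′≢j with completer-colour L 3≤t split (V-vertex L′ 3≤t′) (V-completes L t′≤t j′≢j)
    ...   | inj₁ V′≡U = contradiction (trans V′≡U (split⇒U≡N L 3≤t split)) (V≢N L′ 3≤t′)
    ...   | inj₂ V′≡V = trans V′≡V (split⇒V≡D₁ L 3≤t split)

    TopSplit : ℕ → Set
    TopSplit t = 3 ≤ t × Split t (n t)

    -- A split anywhere in layer t forces u_t(n_t) and v_t(n_t) to take the colours of N and D 1.
    unsplit⇒tied : Layer t j → 3 ≤ t → ¬ TopSplit t → f (U t j) ≡ f (V t j)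
    unsplit⇒tied {t} {j} L 3≤t unsplit with f (U t j) ≟ᶠ f (V t j)
    ... | yes tied = tied
    ... | no split = contradiction (3≤t , top-split) unsplit
      where
      top = top-layer (2≤t L) (t≤s L)
      top-split : Split t (n t)
      top-split U≡V = N≢D₁ (begin
        f N               ≡⟨ sym (split⇒lower-U≡N L 3≤t split top ≤-refl) ⟩
        f (U t (n t))     ≡⟨ U≡V ⟩
        f (V t (n t))     ≡⟨ split⇒lower-V≡D₁ L 3≤t split top 3≤t ≤-refl ⟩
        f (D 1)           ∎)
        where open ≡-Reasoning

    tied⇒U≢N : Layer t j → 3 ≤ t → f (U t j) ≡ f (V t j) → f (U t j) ≢ f N
    tied⇒U≢N L 3≤t U≡V U≡N = V≢N L 3≤t (trans (sym U≡V) U≡N)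

    record Threshold (r : ℕ) : Set where
      field
        lower-U : ∀ {t j} → Layer t j → t ≤ r → f (U t j) ≡ f N
        lower-V : ∀ {t j} → Layer t j → 3 ≤ t → t ≤ r → f (V t j) ≡ f (D 1)
        upper-tied : ∀ {t j} → Layer t j → 3 ≤ t → r < t → f (U t j) ≡ f (V t j)
        upper-U : ∀ {t j} → Layer t j → r < t → f (U t j) ≢ f N

    last-split-threshold : ∀ {r} → r ≤ s → TopSplit r → (∀ t → r < t → t ≤ s → ¬ TopSplit t)
      → Threshold r
    last-split-threshold {r} r≤s (3≤r , split) none-above = record
      { lower-U = λ L t≤r → split⇒lower-U≡N top 3≤r split L t≤r
      ; lower-V = λ L 3≤t t≤r → split⇒lower-V≡D₁ top 3≤r split L 3≤t t≤r
      ; upper-tied = upper-tied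
      ; upper-U = λ L r<t → let 3≤t = ≤-trans 3≤r (<⇒≤ r<t) in tied⇒U≢N L 3≤t (upper-tied L 3≤t r<t)
      }
      where
      top = top-layer (≤-trans (n≤1+n 2) 3≤r) r≤s
      upper-tied : Layer t j → 3 ≤ t → r < t → f (U t j) ≡ f (V t j)
      upper-tied L 3≤t r<t = unsplit⇒tied L 3≤t (none-above _ r<t (t≤s L))

    no-split-threshold : (∀ t → t ≤ s → ¬ TopSplit t) → ∃[ r ] (1 ≤ r × r ≤ s × Threshold r)
    no-split-threshold none with f (U 2 (n 2)) ≟ᶠ f N
    ... | yes U₂≡N = 2 , s≤s z≤n , 2≤s , record
      { lower-U = lower-U
      ; lower-V = λ _ 3≤t t≤2 → contradiction t≤2 (<⇒≱ 3≤t)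
      ; upper-tied = λ L 3≤t _ → unsplit⇒tied L 3≤t (none _ (t≤s L))
      ; upper-U = λ L 2<t → tied⇒U≢N L 2<t (unsplit⇒tied L 2<t (none _ (t≤s L)))
      }
      where
      lower-U : Layer t j → t ≤ 2 → f (U t j) ≡ f N
      lower-U L t≤2 with refl , refl ← second-layer L t≤2 = U₂≡N
    ... | no U₂≢N = 1 , ≤-refl , 1≤s , record
      { lower-U = λ L t≤1 → contradiction t≤1 (<⇒≱ (2≤t L))
      ; lower-V = λ _ 3≤t t≤1 → contradiction t≤1 (<⇒≱ (≤-trans (n≤1+n 2) 3≤t))
      ; upper-tied = λ L 3≤t _ → unsplit⇒tied L 3≤t (none _ (t≤s L))
      ; upper-U = λ L _ → upper-U L
      }
      where
      upper-U : Layer t j → f (U t j) ≢ f N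
      upper-U L with layer-cases L
      ... | inj₂ 3≤t = tied⇒U≢N L 3≤t (unsplit⇒tied L 3≤t (none _ (t≤s L)))
      ... | inj₁ refl with refl ← proj₂ (second-layer L ≤-refl) = U₂≢N

    threshold : ∃[ r ] (1 ≤ r × r ≤ s × Threshold r)
    threshold with largest-below (λ t → 3 ≤? t ×-dec ¬? (f (U t (n t)) ≟ᶠ f (V t (n t)))) s
    ... | inj₁ (r , r≤s , top-split , none-above) =
      r , ≤-trans (s≤s z≤n) (proj₁ top-split) , r≤s , last-split-threshold r≤s top-split none-above
    ... | inj₂ none = no-split-threshold none

    module AtThreshold (p : Fin s) (threshold : Threshold (pos p)) where
      open Threshold threshold

      data Basic : Tuple → Set where
        N-basic : Basic N
        D-basic : 1 ≤ i → i < n s → Basic (D i)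
        U-basic : Layer t j → pos p < t → Basic (U t j)

      basic-at : ∀ {a} → Basic a → ℕ
      basic-at N-basic = n (pos p)
      basic-at (D-basic {i} _ _) = i
      basic-at (U-basic {j = j} _ _) = j

      representative : View x → ∃[ a ] Σ (Basic a) λ a-basic → f x ≡ f a × lookup x p ≡ basic-at a-basic
      representative N-view = N , N-basic , refl , N-at p
      representative (D-view {i} 1≤i i<nₛ) = D i , D-basic 1≤i i<nₛ , refl , D-at i p
      representative (U-view {t} {j} L) with pos p <? t
      ... | yes p<t = U t j , U-basic L p<t , refl , U-at-< j p p<t
      ... | no p≮t = N , N-basic , lower-U L (≮⇒≥ p≮t) , U-at-≥ j p (≮⇒≥ p≮t)
      representative (V-view {t} {j} L 3≤t) with pos p <? t
      ... | yes p<t = U t j , U-basic L p<t , sym (upper-tied L 3≤t p<t) , V-at-< j p p<t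
      ... | no p≮t = D 1 , D-basic ≤-refl 2≤nₛ , lower-V L 3≤t (≮⇒≥ p≮t) , V-at-≥ j p (≮⇒≥ p≮t)

      n≢D-at : i < n s → n (pos p) ≢ i
      n≢D-at i<nₛ = ≢-sym (<⇒≢ (<-≤-trans i<nₛ (nₛ≤n (s≤s z≤n) (pos≤s p))))

      n≢U-at : Layer t j → pos p < t → n (pos p) ≢ j
      n≢U-at L p<t = ≢-sym (<⇒≢ (layer-below L (s≤s z≤n) p<t))

      D≢U-at : i < n s → Layer t j → i ≢ j
      D≢U-at i<nₛ L = <⇒≢ (<-≤-trans i<nₛ (nₛ≤j L))

      basic-injective : ∀ {a b} (a-basic : Basic a) (b-basic : Basic b)
        → basic-at a-basic ≡ basic-at b-basic → a ≡ b
      basic-injective N-basic N-basic _ = refl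
      basic-injective N-basic (D-basic _ i<nₛ) e = contradiction e (n≢D-at i<nₛ)
      basic-injective N-basic (U-basic L p<t) e = contradiction e (n≢U-at L p<t)
      basic-injective (D-basic _ i<nₛ) N-basic e = contradiction (sym e) (n≢D-at i<nₛ)
      basic-injective (D-basic _ _) (D-basic _ _) refl = refl
      basic-injective (D-basic _ i<nₛ) (U-basic L _) e = contradiction e (D≢U-at i<nₛ L)
      basic-injective (U-basic L p<t) N-basic e = contradiction (sym e) (n≢U-at L p<t)
      basic-injective (U-basic L _) (D-basic _ i<nₛ) e = contradiction (sym e) (D≢U-at i<nₛ L)
      basic-injective (U-basic L _) (U-basic L′ _) refl with refl ← layer-unique L L′ = refl

      U≢U : Layer t j → pos p < t → Layer t′ j′ → j < j′ → f (U t j) ≢ f (U t′ j′)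
      U≢U L p<t L′ j<j′ with layer-cases L | layer-antitone L L′ (<⇒≤ j<j′)
      ... | inj₂ 3≤t | t′≤t = λ U≡U′ → V≢U L 3≤t L′ t′≤t j<j′ (trans (sym (upper-tied L 3≤t p<t)) U≡U′)
      ... | inj₁ refl | t′≤2 =
        contradiction (trans (proj₂ (second-layer L ≤-refl)) (sym (proj₂ (second-layer L′ t′≤2)))) (<⇒≢ j<j′)

      basic-separated : ∀ {a b} (a-basic : Basic a) (b-basic : Basic b)
        → basic-at a-basic ≢ basic-at b-basic → f a ≢ f b
      basic-separated N-basic N-basic ne = contradiction refl ne
      basic-separated N-basic (D-basic 1≤i i<nₛ) _ = ≢-sym (D≢N 1≤i i<nₛ)
      basic-separated N-basic (U-basic L p<t) _ = ≢-sym (upper-U L p<t)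
      basic-separated (D-basic 1≤i i<nₛ) N-basic _ = D≢N 1≤i i<nₛ
      basic-separated (D-basic 1≤i i<nₛ) (D-basic 1≤i′ i′<nₛ) i≢i′ = D≢D i≢i′ 1≤i i<nₛ 1≤i′ i′<nₛ
      basic-separated (D-basic 1≤i i<nₛ) (U-basic L _) _ = D≢U 1≤i i<nₛ L
      basic-separated (U-basic L p<t) N-basic _ = upper-U L p<t
      basic-separated (U-basic L _) (D-basic 1≤i i<nₛ) _ = ≢-sym (D≢U 1≤i i<nₛ L)
      basic-separated (U-basic {j = j} L p<t) (U-basic {j = j′} L′ p<t′) j≢j′ with <-cmp j j′
      ... | tri< j<j′ _ _ = U≢U L p<t L′ j<j′
      ... | tri≈ _ j≡j′ _ = contradiction j≡j′ j≢j′
      ... | tri> _ _ j′<j = ≢-sym (U≢U L′ p<t′ L j′<j)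

      colour⇔coordinate : Vertex x → Vertex y → f x ≡ f y ⇔ lookup x p ≡ lookup y p
      colour⇔coordinate {x} {y} x∈G y∈G
        with a , a-basic , fx≡fa , xₚ≡a ← representative (view x∈G)
           | b , b-basic , fy≡fb , yₚ≡b ← representative (view y∈G) = mk⇔ to from
        where
        to : f x ≡ f y → lookup x p ≡ lookup y p
        to fx≡fy with basic-at a-basic ≟ basic-at b-basic
        ... | yes a≡b = trans xₚ≡a (trans a≡b (sym yₚ≡b))
        ... | no a≢b = contradiction (trans (sym fx≡fa) (trans fx≡fy fy≡fb)) (basic-separated a-basic b-basic a≢b)

        from : lookup x p ≡ lookup y p → f x ≡ f y
        from xₚ≡yₚ with refl ← basic-injective a-basic b-basic (trans (sym xₚ≡a) (trans xₚ≡yₚ yₚ≡b)) =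
          trans fx≡fa (sym fy≡fb)

      samePartition-canonical : SamePartition (G* s n) f (canonical p)
      samePartition-canonical x y x∈G y∈G =
        ⇔-trans (colour⇔coordinate x∈G y∈G) (⇔-sym (canonical-≡⇔ (proj₁ x∈G) (proj₁ y∈G) p))

    classify : ∃[ p ] SamePartition (G* s n) f (canonical p)
    classify =
      let r , 1≤r , r≤s , r-threshold = threshold
          p , p≡r = position 1≤r r≤s
      in p , AtThreshold.samePartition-canonical p (subst Threshold (sym p≡r) r-threshold)

  pos-injective-on-sizes : ∀ {p p′} → n (pos p) ≡ n (pos p′) → p ≡ p′
  pos-injective-on-sizes {p} {p′} nₚ≡nₚ′ =
    toℕ-injective (suc-injective (injective (s≤s z≤n) (pos≤s p) (s≤s z≤n) (pos≤s p′) nₚ≡nₚ′))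

  sizes⇔SetS : ∀ k → (∃[ p ] k ≡ n (pos p)) ⇔ SetS s n k
  sizes⇔SetS k = mk⇔
    (λ (p , k≡nₚ) → pos p , s≤s z≤n , pos≤s p , k≡nₚ)
    (λ (t , 1≤t , t≤s , k≡nₜ) → let p , p≡t = position 1≤t t≤s in p , trans k≡nₜ (cong n (sym p≡t)))

theorem2p4 : (s : ℕ) (n : ℕ → ℕ) → 2 ≤ s → 2 ≤ n s
    → (∀ t → 1 ≤ t → t < s → n (suc t) < n t)
    → n 2 ≡ n 1 ∸ 1
    → OneRealization (G* s n) (SetS s n)
theorem2p4 s n 2≤s 2≤nₛ step n₂≡n₁∸1 =
  OneRealization-cong (G* s n) sizes⇔SetS
    (oneRealization-of-canonical (G* s n) (n ∘ pos) pos-injective-on-sizes canonical canonical-strict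
      Classification.classify)
  where
  open Construction s n 2≤s 2≤nₛ step n₂≡n₁∸1
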